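{- Let $q$ be a prime power, let $\mathcal{F}$ be an $n\times m$ Ferrers diagram and let $1\le r\le \min\{n,m\}$ be an integer. Then $\kappa(\mathcal{F},r)\ge 1$ if and only if there exists a matrix $M\in\mathbb{F}_q[\mathcal{F}]$ with $\mathrm{rk}(M)\ge r$.
   Context: For a positive integer $i$, $[i]=\{1,\dots,i\}$. An $n\times m$ Ferrers diagram is a subset $\mathcal{F}\subseteq[n]\times[m]$ such that $(1,1)\in\mathcal{F}$ and $(n,m)\in\mathcal{F}$; if $(i,j)\in\mathcal{F}$ and $j<m$ then $(i,j+1)\in\mathcal{F}$; and if $(i,j)\in\mathcal{F}$ and $i>1$ then $(i-1,j)\in\mathcal{F}$. For $1\le j\le m$ let $c_j=|\{i:(i,j)\in\mathcal{F}\}|$; then $1\le c_1\le\dots\le c_m=n$ and $\mathcal{F}=\{(i,j): 1\le i\le c_j\}$. $\mathbb{F}_q[\mathcal{F}]$ denotes the $\mathbb{F}_q$-space of $n\times m$ matrices $M$ over $\mathbb{F}_q$ with $M_{ij}=0$ whenever $(i,j)\notin\mathcal{F}$. For $1\le d\le\min\{n,m\}$ and $0\le j\le d-1$ set $\kappa_j(\mathcal{F},d)=\sum_{t=1}^{m-d+1+j}\max\{c_t-j,0\}$ and $\kappa(\mathcal{F},d)=\min\{\kappa_j(\mathcal{F},d):0\le j\le d-1\}$. -}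

module Defs where

open import Level using (0ℓ)
open import Data.Nat using (ℕ; zero; suc; _+_; _∸_; _≤_; _<_; _<ᵇ_; _⊓_; _^_)
open import Data.Nat.Primality using (Prime)
open import Data.Fin using (Fin; toℕ)
open import Data.List using (List; map; allFin)
open import Data.Nat.ListAction using (sum)
open import Data.Bool using (if_then_else_)
open import Data.Product using (Σ; ∃; _×_)
open import Relation.Nullary using (¬_)
open import Relation.Binary.PropositionalEquality using (_≡_)
open import Algebra.Bundles using (CommutativeRing)

record Field : Set₁ where
  field
    commRing : CommutativeRing 0ℓ 0ℓ
  open CommutativeRing commRing public
  field
    1≉0     : ¬ (1# ≈ 0#)
    inverse : ∀ x → ¬ (x ≈ 0#) → ∃ λ y → x * y ≈ 1#

HasCardinality : Field → ℕ → Set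
HasCardinality K q =
  Σ (Fin q → Carrier) λ e →
    (∀ a b → e a ≈ e b → a ≡ b) × (∀ x → ∃ λ a → e a ≈ x)
  where open Field K

IsPrimePower : ℕ → Set
IsPrimePower q = ∃ λ p → ∃ λ k → Prime p × (1 ≤ k) × (q ≡ p ^ k)

-- Ferrers diagrams, given by their column lengths c_1 ≤ … ≤ c_m = n
-- (columns indexed 0 … m-1; cell (i,j) (0-indexed) lies in F iff i < c_j).

record Ferrers (n m : ℕ) : Set where
  field
    col     : Fin m → ℕ
    col-pos : ∀ j → 1 ≤ col j
    mono    : ∀ i j → toℕ i ≤ toℕ j → col i ≤ col j
    last    : ∀ j → suc (toℕ j) ≡ m → col j ≡ n

open Ferrers public

_∈F_ : ∀ {n m} → Fin n × Fin m → Ferrers n m → Set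
_∈F_ (i Data.Product., j) F = toℕ i < col F j

-- κ_j(F,d) = Σ_{t=1}^{m-d+1+j} max{c_t - j, 0}
kappaj : ∀ {n m} → Ferrers n m → (d j : ℕ) → ℕ
kappaj {n} {m} F d j =
  sum (map (λ t → if toℕ t <ᵇ (m ∸ d + 1 + j) then col F t ∸ j else 0) (allFin m))

minOver : ℕ → (ℕ → ℕ) → ℕ
minOver zero    f = f 0
minOver (suc k) f = minOver k f ⊓ f (suc k)

-- κ(F,d) = min { κ_j(F,d) : 0 ≤ j ≤ d-1 }   (only used for d ≥ 1)
kappa : ∀ {n m} → Ferrers n m → ℕ → ℕ
kappa F zero    = 0
kappa F (suc d) = minOver d (kappaj F (suc d))

Matrix : Field → ℕ → ℕ → Set
Matrix K n m = Fin n → Fin m → Field.Carrier K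

InFerrersSpace : ∀ {n m} (K : Field) → Ferrers n m → Matrix K n m → Set
InFerrersSpace {n} {m} K F M =
  ∀ (i : Fin n) (j : Fin m) → ¬ (toℕ i < col F j) → M i j ≈ 0#
  where open Field K

fsum : (K : Field) → ∀ {r} → (Fin r → Field.Carrier K) → Field.Carrier K
fsum K {r} f = Data.List.foldr (Field._+_ K) 0# (map f (allFin r))
  where open Field K

RankAtLeast : ∀ {n m} (K : Field) → Matrix K n m → ℕ → Set
RankAtLeast {n} {m} K M r =
  Σ (Fin r → Fin m) λ σ →
    (∀ a b → σ a ≡ σ b → a ≡ b) ×
    (∀ (c : Fin r → Carrier) →
       (∀ i → fsum K (λ k → Field._*_ K (c k) (M i (σ k))) ≈ 0#) →
       ∀ k → c k ≈ 0#)
  where open Field K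

module Submission where

-- κ(F, r) ≥ 1 says exactly that F contains the r cells (j, m − r + j), j < r: κ_j(F, r) ≥ 1 means
-- that one of the first m − r + 1 + j columns is longer than j, and by monotonicity of the column
-- lengths that column may be taken to be the last of them. If F contains this diagonal, the 0/1
-- matrix supported on it lies in F_q[F] and has rank r. If instead the cell (j, t), t = m − r + j,
-- is missing, every column up to t is supported on the top j rows and only r − 1 − j columns lie to
-- the right of t. Encoding r distinct columns by their top j entries followed by the indicator of
-- their position to the right of t gives r vectors in dimension r − 1; these are dependent by
-- Gaussian elimination, and a dependence among them is one among the columns themselves.

open import Level using (0ℓ)
open import Data.Nat using (ℕ; zero; suc; _≤_; _<_; _⊓_; s≤s)
open import Data.Nat.Properties using (≤-trans; m⊓n≤m; m⊓n≤n)
open import Data.Fin using (Fin; zero; suc; toℕ; fromℕ<)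
import Data.Fin as Fin
open import Data.Fin.Properties using (toℕ<n; toℕ-fromℕ<)
open import Data.Product using (∃; _×_; _,_; proj₁; proj₂)
open import Function using (id; _∘_)
open import Function.Bundles using (_⇔_; mk⇔; module Equivalence)
open import Relation.Nullary using (¬_; Dec; yes; no; contradiction)
open import Relation.Nullary.Decidable using (map′)
open import Relation.Binary.PropositionalEquality as ≡ using (_≡_; _≢_)
open import Defs

module DiagonalCriterion where
  open import Data.Nat using (_+_; _∸_; _<ᵇ_; z≤n; s≤s⁻¹)
  open import Data.Nat.Properties
    using ( m≤m+n; m≤n+m; ≤-refl; <-≤-trans; <⇒≢; m≤n⇒m<n∨m≡n; m≤n⇒m≤1+n; ⊓-glb
          ; +-assoc; +-suc; +-cancelˡ-<; +-monoʳ-<; m∸n+n≡m; [m+n]∸[m+o]≡n∸o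
          ; m<n⇒0<n∸m; m∸n≢0⇒n<m; <ᵇ⇒<; <⇒<ᵇ )
  open import Data.Nat.ListAction using (sum)
  open import Data.Bool using (true; T; if_then_else_)
  open import Data.List using (_∷_; map; allFin)
  open import Data.List.Membership.Propositional using (_∈_)
  open import Data.List.Membership.Propositional.Properties using (∈-map⁺; ∈-allFin)
  open import Data.List.Relation.Unary.Any using (Any; here; there; satisfied)
  open import Data.List.Relation.Unary.Any.Properties using (map⁻)
  open import Data.Sum using (inj₁; inj₂)
  open ≡ using (refl)

  ∈⇒≤sum : ∀ {n ns} → n ∈ ns → n ≤ sum ns
  ∈⇒≤sum {ns = n ∷ ns} (here refl) = m≤m+n n (sum ns)
  ∈⇒≤sum {ns = m ∷ ns} (there n∈ns) = ≤-trans (∈⇒≤sum n∈ns) (m≤n+m (sum ns) m)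

  1≤sum⇒Any : ∀ ns → 1 ≤ sum ns → Any (1 ≤_) ns
  1≤sum⇒Any (zero  ∷ ns) 1≤Σ = there (1≤sum⇒Any ns 1≤Σ)
  1≤sum⇒Any (suc n ∷ ns) _   = here (s≤s z≤n)

  ≤minOver⇔ : ∀ {b} d f → b ≤ minOver d f ⇔ (∀ j → j ≤ d → b ≤ f j)
  ≤minOver⇔ d f = mk⇔ (to d) (from d)
    where
    to : ∀ {b} d → b ≤ minOver d f → ∀ j → j ≤ d → b ≤ f j
    to zero    b≤ zero z≤n = b≤
    to (suc d) b≤ j j≤d with m≤n⇒m<n∨m≡n j≤d
    ... | inj₁ j<d = to d (≤-trans b≤ (m⊓n≤m _ _)) j (s≤s⁻¹ j<d)
    ... | inj₂ refl = ≤-trans b≤ (m⊓n≤n _ _)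
    from : ∀ {b} d → (∀ j → j ≤ d → b ≤ f j) → b ≤ minOver d f
    from zero    b≤f = b≤f 0 z≤n
    from (suc d) b≤f = ⊓-glb (from d λ j j≤d → b≤f j (m≤n⇒m≤1+n j≤d)) (b≤f (suc d) ≤-refl)

  1≤if⇒ : ∀ b {x} → 1 ≤ (if b then x else 0) → T b × 1 ≤ x
  1≤if⇒ true 1≤x = _ , 1≤x

  T⇒if≡then : ∀ {b} {x y : ℕ} → T b → (if b then x else y) ≡ x
  T⇒if≡then {true} _ = refl

  m∸n+o<m⇔o<n : ∀ {r m} j → r ≤ m → m ∸ r + j < m ⇔ j < r
  m∸n+o<m⇔o<n {r} {m} j r≤m = mk⇔
    (λ lt → +-cancelˡ-< (m ∸ r) j r (≡.subst (m ∸ r + j <_) (≡.sym m≡) lt))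
    (λ lt → ≡.subst (m ∸ r + j <_) m≡ (+-monoʳ-< (m ∸ r) lt))
    where
    m≡ : m ∸ r + r ≡ m
    m≡ = m∸n+n≡m r≤m

  m∸[1+m∸n+o]≡n∸[1+o] : ∀ {m n o} → n ≤ m → m ∸ suc (m ∸ n + o) ≡ n ∸ suc o
  m∸[1+m∸n+o]≡n∸[1+o] {m} {n} {o} n≤m = begin
    m ∸ suc (m ∸ n + o)          ≡⟨ ≡.cong (_∸ suc (m ∸ n + o)) (m∸n+n≡m n≤m) ⟨
    m ∸ n + n ∸ suc (m ∸ n + o)  ≡⟨ ≡.cong (m ∸ n + n ∸_) (+-suc (m ∸ n) o) ⟨
    m ∸ n + n ∸ (m ∸ n + suc o)  ≡⟨ [m+n]∸[m+o]≡n∸o (m ∸ n) n (suc o) ⟩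
    n ∸ suc o                    ∎
    where open ≡.≡-Reasoning

  -- The cells (j , m ∸ r + j), j < r, 0-indexed: the diagonal of the top-right r × r square.
  ContainsDiagonal : ∀ {n m} → Ferrers n m → ℕ → Set
  ContainsDiagonal {m = m} F r = ∀ (t : Fin m) j → toℕ t ≡ m ∸ r + j → j < col F t

  module _ {n m} (F : Ferrers n m) {r} (r≤m : r ≤ m) where

    1≤kappaj⇔ : ∀ {t : Fin m} {j} → toℕ t ≡ m ∸ r + j → 1 ≤ kappaj F r j ⇔ j < col F t
    1≤kappaj⇔ {t} {j} t≡ = mk⇔ to from
      where
      bound : ℕ
      bound = m ∸ r + 1 + j
      g : Fin m → ℕ
      g t′ = if toℕ t′ <ᵇ bound then col F t′ ∸ j else 0
      bound≡ : bound ≡ suc (toℕ t)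
      bound≡ = begin
        m ∸ r + 1 + j    ≡⟨ +-assoc (m ∸ r) 1 j ⟩
        m ∸ r + suc j    ≡⟨ +-suc (m ∸ r) j ⟩
        suc (m ∸ r + j)  ≡⟨ ≡.cong suc (≡.sym t≡) ⟩
        suc (toℕ t)      ∎
        where open ≡.≡-Reasoning
      to : 1 ≤ kappaj F r j → j < col F t
      to 1≤κ with satisfied (map⁻ (1≤sum⇒Any (map g (allFin m)) 1≤κ))
      ... | t′ , 1≤gt′ with 1≤if⇒ (toℕ t′ <ᵇ bound) 1≤gt′
      ...   | t′<bound , 1≤ct′∸j = <-≤-trans j<ct′ (mono F t′ t t′≤t)
        where
        j<ct′ : j < col F t′
        j<ct′ = m∸n≢0⇒n<m (λ eq → <⇒≢ 1≤ct′∸j (≡.sym eq))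
        t′≤t : toℕ t′ ≤ toℕ t
        t′≤t = s≤s⁻¹ (≡.subst (toℕ t′ <_) bound≡ (<ᵇ⇒< _ _ t′<bound))
      from : j < col F t → 1 ≤ kappaj F r j
      from j<ct = ≤-trans 1≤gt (∈⇒≤sum (∈-map⁺ g (∈-allFin t)))
        where
        1≤gt : 1 ≤ g t
        1≤gt = ≡.subst (1 ≤_) (≡.sym (T⇒if≡then (<⇒<ᵇ t<bound))) (m<n⇒0<n∸m j<ct)
          where
          t<bound : toℕ t < bound
          t<bound = ≡.subst (toℕ t <_) (≡.sym bound≡) ≤-refl

    1≤kappa⇔containsDiagonal : 1 ≤ r → 1 ≤ kappa F r ⇔ ContainsDiagonal F r
    1≤kappa⇔containsDiagonal (s≤s {n = d} z≤n) = mk⇔ to from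
      where
      to : 1 ≤ kappa F r → ContainsDiagonal F r
      to 1≤κ t j t≡ = Equivalence.to (1≤kappaj⇔ t≡) (Equivalence.to (≤minOver⇔ d (kappaj F r)) 1≤κ j j≤d)
        where
        j≤d : j ≤ d
        j≤d = s≤s⁻¹ (Equivalence.to (m∸n+o<m⇔o<n j r≤m) (≡.subst (_< m) t≡ (toℕ<n t)))
      from : ContainsDiagonal F r → 1 ≤ kappa F r
      from diag = Equivalence.from (≤minOver⇔ d (kappaj F r)) λ j j≤d →
        let lt = Equivalence.from (m∸n+o<m⇔o<n j r≤m) (s≤s j≤d)
            t≡ = toℕ-fromℕ< lt
        in Equivalence.from (1≤kappaj⇔ t≡) (diag (fromℕ< lt) j t≡)

open DiagonalCriterion using (ContainsDiagonal; m∸n+o<m⇔o<n; m∸[1+m∸n+o]≡n∸[1+o]; 1≤kappa⇔containsDiagonal)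

module LinearAlgebra (K : Field) (_≈0? : ∀ x → Dec (Field._≈_ K x (Field.0# K))) where
  open import Data.Fin using (punchIn; punchOut)
  open import Data.Fin.Properties using (punchInᵢ≢i; punchIn-punchOut; all?; ¬∀⟶∃¬)
  open import Data.List using (foldr; tabulate)
  open import Data.List.Properties using (map-tabulate)
  open import Relation.Unary using (Pred; Decidable)
  open Field K hiding (zero)
  open import Algebra.Properties.Ring ring using (-‿distribˡ-*)
  open import Algebra.Properties.Semiring.Sum semiring
    using (sum-syntax; sum-cong-≋; ∑-distrib-+; *-distribʳ-sum; sum-remove; sum-replicate-zero)
  open import Relation.Binary.Reasoning.Setoid setoid

  foldr-tabulate : ∀ {s} (f : Fin s → Carrier) → foldr _+_ 0# (tabulate f) ≡ ∑[ k < s ] f k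
  foldr-tabulate {zero}  f = ≡.refl
  foldr-tabulate {suc s} f = ≡.cong (f zero +_) (foldr-tabulate (f ∘ suc))

  fsum≡∑ : ∀ {s} (f : Fin s → Carrier) → fsum K f ≡ ∑[ k < s ] f k
  fsum≡∑ f = ≡.trans (≡.cong (foldr _+_ 0#) (map-tabulate id f)) (foldr-tabulate f)

  ∑-zero : ∀ {s} {f : Fin s → Carrier} → (∀ k → f k ≈ 0#) → ∑[ k < s ] f k ≈ 0#
  ∑-zero {s} f≈0 = trans (sum-cong-≋ f≈0) (sum-replicate-zero s)

  ∑-single : ∀ {s} (f : Fin s → Carrier) k → (∀ k′ → k′ ≢ k → f k′ ≈ 0#) → ∑[ k′ < s ] f k′ ≈ f k
  ∑-single {suc s} f k f≈0 = begin
    ∑[ k′ < _ ] f k′                   ≈⟨ sum-remove {i = k} f ⟩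
    f k + ∑[ k′ < _ ] f (punchIn k k′)  ≈⟨ +-congˡ (∑-zero (λ k′ → f≈0 (punchIn k k′) (punchInᵢ≢i k k′))) ⟩
    f k + 0#                           ≈⟨ +-identityʳ (f k) ⟩
    f k                                ∎

  indicator : ∀ {A : Set} → Dec A → Carrier
  indicator (yes _) = 1#
  indicator (no _)  = 0#

  indicator-yes : ∀ {A : Set} → A → (a? : Dec A) → indicator a? ≡ 1#
  indicator-yes a (yes _) = ≡.refl
  indicator-yes a (no ¬a) = contradiction a ¬a

  indicator-no : ∀ {A : Set} → ¬ A → (a? : Dec A) → indicator a? ≡ 0#
  indicator-no ¬a (yes a) = contradiction a ¬a
  indicator-no ¬a (no _)  = ≡.refl

  ∑-*-indicator : ∀ {s} (c : Fin s → Carrier) {P : Pred (Fin s) 0ℓ} (P? : Decidable P) k →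
                  P k → (∀ k′ → P k′ → k′ ≡ k) → ∑[ k′ < s ] (c k′ * indicator (P? k′)) ≈ c k
  ∑-*-indicator c P? k Pk unique = begin
    ∑[ k′ < _ ] (c k′ * indicator (P? k′)) ≈⟨ ∑-single _ k (λ k′ k′≢k →
                                                 trans (*-congˡ (reflexive (indicator-no (k′≢k ∘ unique k′) (P? k′)))) (zeroʳ _)) ⟩
    c k * indicator (P? k)                 ≈⟨ *-congˡ (reflexive (indicator-yes Pk (P? k))) ⟩
    c k * 1#                               ≈⟨ *-identityʳ (c k) ⟩
    c k                                    ∎

  LinearlyDependent : ∀ {s p} → (Fin s → Fin p → Carrier) → Set
  LinearlyDependent {s} v =
    ∃ λ (c : Fin s → Carrier) → (∃ λ k → ¬ c k ≈ 0#) × (∀ i → ∑[ k < s ] (c k * v k i) ≈ 0#)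

  zeroVector⇒dependent : ∀ {s p} (v : Fin s → Fin p → Carrier) k → (∀ i → v k i ≈ 0#) → LinearlyDependent v
  zeroVector⇒dependent v k vk≈0 = c , (k , c≉0) , combination≈0
    where
    c : Fin _ → Carrier
    c k′ = indicator (k′ Fin.≟ k)
    c≉0 : ¬ c k ≈ 0#
    c≉0 = 1≉0 ∘ trans (reflexive (≡.sym (indicator-yes ≡.refl (k Fin.≟ k))))
    combination≈0 : ∀ i → ∑[ k′ < _ ] (c k′ * v k′ i) ≈ 0#
    combination≈0 i = begin
      ∑[ k′ < _ ] (c k′ * v k′ i) ≈⟨ ∑-single _ k (λ k′ k′≢k →
                                       trans (*-congʳ (reflexive (indicator-no k′≢k (k′ Fin.≟ k)))) (zeroˡ _)) ⟩
      c k * v k i                 ≈⟨ *-congˡ (vk≈0 i) ⟩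
      c k * 0#                    ≈⟨ zeroʳ (c k) ⟩
      0#                          ∎

  ∑-absorb : ∀ {s} (c b x : Fin s → Carrier) x₀ →
             ∑[ k < s ] (c k * b k) * x₀ + ∑[ k < s ] (c k * x k) ≈ ∑[ k < s ] (c k * (x k + b k * x₀))
  ∑-absorb c b x x₀ = begin
    ∑[ k < _ ] (c k * b k) * x₀ + ∑[ k < _ ] (c k * x k)      ≈⟨ +-congʳ (*-distribʳ-sum x₀ (λ k → c k * b k)) ⟩
    ∑[ k < _ ] (c k * b k * x₀) + ∑[ k < _ ] (c k * x k)      ≈⟨ +-comm _ _ ⟩
    ∑[ k < _ ] (c k * x k) + ∑[ k < _ ] (c k * b k * x₀)      ≈⟨ ∑-distrib-+ (λ k → c k * x k) (λ k → c k * b k * x₀) ⟨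
    ∑[ k < _ ] (c k * x k + c k * b k * x₀)                  ≈⟨ sum-cong-≋ (λ k → +-congˡ (*-assoc (c k) (b k) x₀)) ⟩
    ∑[ k < _ ] (c k * x k + c k * (b k * x₀))                ≈⟨ sum-cong-≋ (λ k → distribˡ (c k) (x k) (b k * x₀)) ⟨
    ∑[ k < _ ] (c k * (x k + b k * x₀))                      ∎

  -- Gaussian elimination: subtracting multiples of v₀ clears the pivot coordinate i₀ of the other
  -- vectors, which then live in K^p.
  module Elimination {s p} (v : Fin (suc s) → Fin (suc p) → Carrier) i₀ (v₀i₀≉0 : ¬ v zero i₀ ≈ 0#) where

    w : Carrier
    w = proj₁ (inverse (v zero i₀) v₀i₀≉0)

    b : Fin s → Carrier
    b k = - (v (suc k) i₀ * w)

    cleared : Fin s → Fin (suc p) → Carrier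
    cleared k i = v (suc k) i + b k * v zero i

    cleared-i₀ : ∀ k → cleared k i₀ ≈ 0#
    cleared-i₀ k = begin
      x + - (x * w) * y  ≈⟨ +-congˡ (-‿distribˡ-* (x * w) y) ⟨
      x + - (x * w * y)  ≈⟨ +-congˡ (-‿cong (*-assoc x w y)) ⟩
      x + - (x * (w * y)) ≈⟨ +-congˡ (-‿cong (*-congˡ (trans (*-comm w y) (proj₂ (inverse y v₀i₀≉0))))) ⟩
      x + - (x * 1#)     ≈⟨ +-congˡ (-‿cong (*-identityʳ x)) ⟩
      x + - x            ≈⟨ -‿inverseʳ x ⟩
      0#                 ∎
      where
      x y : Carrier
      x = v (suc k) i₀
      y = v zero i₀

    pivot⇒dependent : (∀ (u : Fin s → Fin p → Carrier) → LinearlyDependent u) → LinearlyDependent v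
    pivot⇒dependent dependent with dependent (λ k j → cleared k (punchIn i₀ j))
    ... | c′ , (k , c′k≉0) , c′u≈0 = c , (suc k , c′k≉0) , combination≈0
      where
      c : Fin (suc s) → Carrier
      c zero    = ∑[ k < s ] (c′ k * b k)
      c (suc k) = c′ k
      combination≈0 : ∀ i → ∑[ k < suc s ] (c k * v k i) ≈ 0#
      combination≈0 i with i₀ Fin.≟ i
      ... | yes ≡.refl = trans (∑-absorb c′ b _ _) (∑-zero λ k → trans (*-congˡ (cleared-i₀ k)) (zeroʳ _))
      ... | no i₀≢i = trans (∑-absorb c′ b _ _)
                       (≡.subst (λ i → ∑[ k < s ] (c′ k * cleared k i) ≈ 0#)
                                (punchIn-punchOut i₀≢i) (c′u≈0 (punchOut i₀≢i)))

  open Elimination using (pivot⇒dependent)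

  >dim⇒dependent : ∀ {s p} → p < s → (v : Fin s → Fin p → Carrier) → LinearlyDependent v
  >dim⇒dependent {suc s} {zero}  _         v = zeroVector⇒dependent v zero (λ ())
  >dim⇒dependent {suc s} {suc p} (s≤s p<s) v with all? (λ i → v zero i ≈0?)
  ... | yes v₀≈0 = zeroVector⇒dependent v zero v₀≈0
  ... | no v₀≉0 with ¬∀⟶∃¬ _ _ (λ i → v zero i ≈0?) v₀≉0
  ...   | i₀ , v₀i₀≉0 = pivot⇒dependent v i₀ v₀i₀≉0 (>dim⇒dependent p<s)

module RankCriterion (K : Field) (_≈0? : ∀ x → Dec (Field._≈_ K x (Field.0# K))) where
  open import Data.Nat using (_+_; _∸_)
  open import Data.Nat.Properties
    using ( ≤-reflexive; <-≤-trans; <⇒≤; ≮⇒≥; +-cancelˡ-≡; ∸-monoˡ-<; m+[n∸m]≡n; _≟_; _<?_ )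
  open import Data.Fin using (inject≤; splitAt; _↑ˡ_; _↑ʳ_)
  open import Data.Fin.Properties using (toℕ-injective; toℕ-inject≤; splitAt-↑ˡ; splitAt-↑ʳ)
  open import Data.Sum using ([_,_])
  open Field K hiding (zero; _+_)
  open LinearAlgebra K _≈0?
  open import Algebra.Properties.Semiring.Sum semiring using (sum-syntax; sum-cong-≋)
  open import Relation.Binary.Reasoning.Setoid setoid

  module _ {n m r} (r≤n : r ≤ n) (r≤m : r ≤ m) where

    diagonalColumn : Fin r → Fin m
    diagonalColumn k = fromℕ< (Equivalence.from (m∸n+o<m⇔o<n (toℕ k) r≤m) (toℕ<n k))

    toℕ-diagonalColumn : ∀ k → toℕ (diagonalColumn k) ≡ m ∸ r + toℕ k
    toℕ-diagonalColumn k = toℕ-fromℕ< _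

    diagonalMatrix : Matrix K n m
    diagonalMatrix i l = indicator (toℕ l ≟ m ∸ r + toℕ i)

    diagonalMatrix∈ : ∀ {F : Ferrers n m} → ContainsDiagonal F r → InFerrersSpace K F diagonalMatrix
    diagonalMatrix∈ diag i l i≮cl =
      reflexive (indicator-no (λ l≡ → i≮cl (diag l (toℕ i) l≡)) (toℕ l ≟ m ∸ r + toℕ i))

    diagonalMatrix-rank : RankAtLeast K diagonalMatrix r
    diagonalMatrix-rank = diagonalColumn , injective , independent
      where
      injective : ∀ a b → diagonalColumn a ≡ diagonalColumn b → a ≡ b
      injective a b eq = toℕ-injective (+-cancelˡ-≡ (m ∸ r) _ _
        (≡.trans (≡.sym (toℕ-diagonalColumn a)) (≡.trans (≡.cong toℕ eq) (toℕ-diagonalColumn b))))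
      independent : ∀ c → (∀ i → fsum K (λ k → c k * diagonalMatrix i (diagonalColumn k)) ≈ 0#) → ∀ k → c k ≈ 0#
      independent c c≈0 k = begin
        c k                              ≈⟨ ∑-*-indicator c row-i k column-k unique ⟨
        ∑[ k′ < r ] (c k′ * entry k′)    ≈⟨ reflexive (fsum≡∑ (λ k′ → c k′ * entry k′)) ⟨
        fsum K (λ k′ → c k′ * entry k′)  ≈⟨ c≈0 i ⟩
        0#                               ∎
        where
        i : Fin n
        i = inject≤ k r≤n
        entry : Fin r → Carrier
        entry k′ = diagonalMatrix i (diagonalColumn k′)
        row-i : ∀ k′ → Dec (toℕ (diagonalColumn k′) ≡ m ∸ r + toℕ i)
        row-i k′ = toℕ (diagonalColumn k′) ≟ m ∸ r + toℕ i
        column-k : toℕ (diagonalColumn k) ≡ m ∸ r + toℕ i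
        column-k = ≡.trans (toℕ-diagonalColumn k) (≡.cong (m ∸ r +_) (≡.sym (toℕ-inject≤ k r≤n)))
        unique : ∀ k′ → toℕ (diagonalColumn k′) ≡ m ∸ r + toℕ i → k′ ≡ k
        unique k′ eq = injective k′ k (toℕ-injective (≡.trans eq (≡.sym column-k)))

  module MissingCell {n m} (F : Ferrers n m) {r} (r≤n : r ≤ n) (r≤m : r ≤ m)
                     (M : Matrix K n m) (M∈F : InFerrersSpace K F M)
                     (t : Fin m) j (t≡ : toℕ t ≡ m ∸ r + j) (ct≤j : col F t ≤ j)
                     (σ : Fin r → Fin m) (σ-injective : ∀ a b → σ a ≡ σ b → a ≡ b) where

    e : ℕ
    e = m ∸ suc (toℕ t)

    j<r : j < r
    j<r = Equivalence.to (m∸n+o<m⇔o<n j r≤m) (≡.subst (_< m) t≡ (toℕ<n t))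

    j≤n : j ≤ n
    j≤n = <⇒≤ (<-≤-trans j<r r≤n)

    j+e<r : j + e < r
    j+e<r = ≤-reflexive (≡.trans (≡.cong (λ t′ → suc j + (m ∸ suc t′)) t≡)
                                 (≡.trans (≡.cong (suc j +_) (m∸[1+m∸n+o]≡n∸[1+o] r≤m)) (m+[n∸m]≡n j<r)))

    profile : Fin r → Fin (j + e) → Carrier
    profile k = [ (λ a → M (inject≤ a j≤n) (σ k))
                , (λ b → indicator (toℕ (σ k) ≟ suc (toℕ t) + toℕ b))
                ] ∘ splitAt j

    profile-top : ∀ k a → profile k (a ↑ˡ e) ≡ M (inject≤ a j≤n) (σ k)
    profile-top k a = ≡.cong [ _ , _ ] (splitAt-↑ˡ j a e)

    profile-right : ∀ k b → profile k (j ↑ʳ b) ≡ indicator (toℕ (σ k) ≟ suc (toℕ t) + toℕ b)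
    profile-right k b = ≡.cong [ _ , _ ] (splitAt-↑ʳ j e b)

    columns-dependent : LinearlyDependent (λ k i → M i (σ k))
    columns-dependent with >dim⇒dependent j+e<r profile
    ... | c , (k₀ , c≉0) , cP≈0 = c , (k₀ , c≉0) , cM≈0
      where
      right-vanish : ∀ k → toℕ t < toℕ (σ k) → c k ≈ 0#
      right-vanish k t<σk = begin
        c k                                                          ≈⟨ ∑-*-indicator c column? k σk≡ unique ⟨
        ∑[ k′ < r ] (c k′ * indicator (column? k′))                  ≈⟨ sum-cong-≋ (λ k′ → *-congˡ (reflexive (profile-right k′ b))) ⟨
        ∑[ k′ < r ] (c k′ * profile k′ (j ↑ʳ b))                     ≈⟨ cP≈0 (j ↑ʳ b) ⟩
        0#                                                           ∎
        where
        b : Fin e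
        b = fromℕ< (∸-monoˡ-< (toℕ<n (σ k)) t<σk)
        column? : ∀ k′ → Dec (toℕ (σ k′) ≡ suc (toℕ t) + toℕ b)
        column? k′ = toℕ (σ k′) ≟ suc (toℕ t) + toℕ b
        σk≡ : toℕ (σ k) ≡ suc (toℕ t) + toℕ b
        σk≡ = ≡.sym (≡.trans (≡.cong (suc (toℕ t) +_) (toℕ-fromℕ< _)) (m+[n∸m]≡n t<σk))
        unique : ∀ k′ → toℕ (σ k′) ≡ suc (toℕ t) + toℕ b → k′ ≡ k
        unique k′ eq = σ-injective k′ k (toℕ-injective (≡.trans eq (≡.sym σk≡)))
      cM≈0 : ∀ i → ∑[ k < r ] (c k * M i (σ k)) ≈ 0#
      cM≈0 i with toℕ i <? j
      ... | yes i<j = trans (sum-cong-≋ λ k → *-congˡ (reflexive (row-i k))) (cP≈0 (a ↑ˡ e))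
        where
        a : Fin j
        a = fromℕ< i<j
        row-i : ∀ k → M i (σ k) ≡ profile k (a ↑ˡ e)
        row-i k = ≡.sym (≡.trans (profile-top k a) (≡.cong (λ i′ → M i′ (σ k)) inject≤a≡i))
          where
          inject≤a≡i : inject≤ a j≤n ≡ i
          inject≤a≡i = toℕ-injective (≡.trans (toℕ-inject≤ a j≤n) (toℕ-fromℕ< i<j))
      ... | no i≮j = ∑-zero term≈0
        where
        term≈0 : ∀ k → c k * M i (σ k) ≈ 0#
        term≈0 k with toℕ t <? toℕ (σ k)
        ... | yes t<σk = trans (*-congʳ (right-vanish k t<σk)) (zeroˡ _)
        ... | no t≮σk = trans (*-congˡ (M∈F i (σ k) (λ i<cσk →
                          i≮j (<-≤-trans i<cσk (≤-trans (mono F (σ k) t (≮⇒≥ t≮σk)) ct≤j))))) (zeroʳ _)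

  rank⇒containsDiagonal : ∀ {n m} {F : Ferrers n m} {r} → r ≤ n → r ≤ m →
                          ∀ {M} → InFerrersSpace K F M → RankAtLeast K M r → ContainsDiagonal F r
  rank⇒containsDiagonal {F = F} r≤n r≤m {M} M∈F (σ , σ-injective , independent) t j t≡ with j <? col F t
  ... | yes j<ct = j<ct
  ... | no j≮ct with MissingCell.columns-dependent F r≤n r≤m M M∈F t j t≡ (≮⇒≥ j≮ct) σ σ-injective
  ...   | c , (k , c≉0) , cM≈0 = contradiction (independent c cM≈0′ k) c≉0
    where
    cM≈0′ : ∀ i → fsum K (λ k′ → c k′ * M i (σ k′)) ≈ 0#
    cM≈0′ i = trans (reflexive (fsum≡∑ (λ k′ → c k′ * M i (σ k′)))) (cM≈0 i)

finite⇒≈-decidable : ∀ {q} (K : Field) → HasCardinality K q → ∀ x y → Dec (Field._≈_ K x y)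
finite⇒≈-decidable K (e , e-injective , e-surjective) x y
  with e-surjective x | e-surjective y
... | a , ea≈x | b , eb≈y = map′ (λ a≡b → trans (sym ea≈x) (trans (reflexive (≡.cong e a≡b)) eb≈y))
                                  (λ x≈y → e-injective a b (trans ea≈x (trans x≈y (sym eb≈y))))
                                  (a Fin.≟ b)
  where open Field K

proposition2p14 : (q : ℕ) → IsPrimePower q → (K : Field) → HasCardinality K q →
    (n m : ℕ) → (F : Ferrers n m) → (r : ℕ) → 1 ≤ r → r ≤ n ⊓ m →
    (1 ≤ kappa F r) ⇔ (∃ λ (M : Matrix K n m) → InFerrersSpace K F M × RankAtLeast K M r)
-- Finiteness of K is only used to decide equality in K.
proposition2p14 q _ K card n m F r 1≤r r≤n⊓m = mk⇔
  (λ 1≤κ → diagonalMatrix r≤n r≤m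
         , diagonalMatrix∈ r≤n r≤m {F} (Equivalence.to κ⇔diag 1≤κ)
         , diagonalMatrix-rank r≤n r≤m)
  (λ (M , M∈F , rank) → Equivalence.from κ⇔diag (rank⇒containsDiagonal {F = F} r≤n r≤m M∈F rank))
  where
  open RankCriterion K (λ x → finite⇒≈-decidable K card x (Field.0# K))
  r≤n : r ≤ n
  r≤n = ≤-trans r≤n⊓m (m⊓n≤m n m)
  r≤m : r ≤ m
  r≤m = ≤-trans r≤n⊓m (m⊓n≤n n m)
  κ⇔diag : 1 ≤ kappa F r ⇔ ContainsDiagonal F r
  κ⇔diag = 1≤kappa⇔containsDiagonal F r≤m 1≤r
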